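{- Let $\vec a\cdot\vec x=\sum_{i=1}^na_ix_i$ be a linear form with integer coefficients in $n$ variables, and let $\mathcal A=\{\vec a\cdot\vec x:\vec x\in\{0,1\}^n\}$. Then there is an R(lin) proof (from no premises) of $\bigvee_{\alpha\in\mathcal A}(\vec a\cdot\vec x=\alpha)$ of size polynomial in $\sum_{i=1}^n|a_i|$. Moreover, if the coefficients in $\vec a$ are constants, there is such an $\mathrm{R}^0(\mathrm{lin})$ proof of size polynomial in $\sum_{i=1}^n|a_i|$.
   Context: Linear equations $\vec a\cdot\vec x=a_0$ have integer coefficients and size $\sum_{i=0}^n|a_i|$ (unary); a disjunction of linear equations is satisfied iff some equation holds; size = total size. A clause $\bigvee_{i\in I}x_i\vee\bigvee_{j\in J}\neg x_j$ translates to $\bigvee_{i\in I}(x_i=1)\vee\bigvee_{j\in J}(x_j=0)$. An R(lin) proof: each line is an initial disjunction, a Boolean axiom $(x_h=0)\vee(x_h=1)$, or derived by Resolution (from $A\vee L_1$, $B\vee L_2$ derive $A\vee B\vee(L_1+L_2)$ or $A\vee B\vee(L_1-L_2)$), Weakening (from $A$ derive $A\vee L$), Simplification (from $A\vee(0=k)$, $k\ne0$, derive $A$). An $\mathrm{R}^0(\mathrm{lin})$-line is a disjunction of linear equations whose variable coefficients are integers bounded by a fixed constant (free terms unbounded), partitionable into a constant number of sub-disjunctions each consisting of equations differing only in free terms or being a translated clause; an $\mathrm{R}^0(\mathrm{lin})$ proof is an R(lin) proof with all lines $\mathrm{R}^0(\mathrm{lin})$-lines. -}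

module Defs where

open import Data.Nat using (ℕ; zero; suc; _≤_; _+_; _*_; _^_)
import Data.Integer as ℤ
open ℤ using (ℤ; ∣_∣; +_)
open import Data.Bool using (Bool; true; false)
open import Data.Fin using (Fin)
open import Data.Vec using (Vec; []; _∷_; replicate; zipWith; lookup; _[_]≔_)
import Data.Vec as Vec
open import Data.List using (List; []; _∷_; _++_; map; concat; length)
import Data.List as List
open import Data.Nat.ListAction using () renaming (sum to listSum)
open import Data.List.Membership.Propositional using (_∈_)
open import Data.List.Relation.Binary.Permutation.Propositional using (_↭_)
open import Data.List.Relation.Unary.All using (All)
open import Data.Product using (Σ; ∃; ∃₂; _×_; _,_)
open import Data.Sum using (_⊎_)
open import Relation.Binary.PropositionalEquality using (_≡_; _≢_)

infix 4 _≐_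

record LinEq (n : ℕ) : Set where
  constructor _≐_
  field
    coeffs : Vec ℤ n
    free   : ℤ
open LinEq public

-- Disjunctions of linear equations (read as sets: see _≈_ below)
Disj : ℕ → Set
Disj n = List (LinEq n)

coeffSize : ∀ {n} → Vec ℤ n → ℕ
coeffSize a = Vec.sum (Vec.map ∣_∣ a)

eqSize : ∀ {n} → LinEq n → ℕ
eqSize (a ≐ a₀) = coeffSize a + ∣ a₀ ∣

disjSize : ∀ {n} → Disj n → ℕ
disjSize D = listSum (map eqSize D)

proofSize : ∀ {n} → List (Disj n) → ℕ
proofSize Γ = listSum (map disjSize Γ)

_≈_ : ∀ {n} → Disj n → Disj n → Set
A ≈ B = ∀ e → (e ∈ A → e ∈ B) × (e ∈ B → e ∈ A)

_⊕_ : ∀ {n} → LinEq n → LinEq n → LinEq n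
(a ≐ a₀) ⊕ (b ≐ b₀) = zipWith ℤ._+_ a b ≐ (a₀ ℤ.+ b₀)

_⊖_ : ∀ {n} → LinEq n → LinEq n → LinEq n
(a ≐ a₀) ⊖ (b ≐ b₀) = zipWith ℤ._-_ a b ≐ (a₀ ℤ.- b₀)

unit : ∀ {n} → Fin n → Vec ℤ n
unit {n} h = replicate n (+ 0) [ h ]≔ + 1

zeroEq : ∀ {n} → ℤ → LinEq n
zeroEq {n} k = replicate n (+ 0) ≐ k

boolAxiom : ∀ {n} → Fin n → Disj n
boolAxiom h = (unit h ≐ + 0) ∷ (unit h ≐ + 1) ∷ []

-- R(lin) inference rules (no initial disjunctions: proofs from no premises).
-- Γ is the list of previously derived lines.

data Rule {n : ℕ} (Γ : List (Disj n)) (D : Disj n) : Set where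
  boolAx : (h : Fin n) → D ≈ boolAxiom h → Rule Γ D
  resol+ : ∀ {P Q} (A B : Disj n) (L₁ L₂ : LinEq n) → P ∈ Γ → Q ∈ Γ →
           P ≈ (L₁ ∷ A) → Q ≈ (L₂ ∷ B) → D ≈ ((L₁ ⊕ L₂) ∷ (A ++ B)) → Rule Γ D
  resol- : ∀ {P Q} (A B : Disj n) (L₁ L₂ : LinEq n) → P ∈ Γ → Q ∈ Γ →
           P ≈ (L₁ ∷ A) → Q ≈ (L₂ ∷ B) → D ≈ ((L₁ ⊖ L₂) ∷ (A ++ B)) → Rule Γ D
  weak   : ∀ {P} (L : LinEq n) → P ∈ Γ → D ≈ (L ∷ P) → Rule Γ D
  simp   : ∀ {P} (k : ℤ) → k ≢ + 0 → P ∈ Γ → P ≈ (zeroEq k ∷ D) → Rule Γ D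

-- A derivation: list of lines, newest first; each line follows from earlier ones.
data Derivation {n : ℕ} : List (Disj n) → Set where
  []      : Derivation []
  _∷⟨_⟩_ : ∀ {Γ} (D : Disj n) → Rule Γ D → Derivation Γ → Derivation (D ∷ Γ)

RlinProof : ∀ {n} → List (Disj n) → Disj n → Set
RlinProof {n} Γ T = Derivation Γ × ∃₂ λ (D : Disj n) (Γ' : List (Disj n)) → (Γ ≡ D ∷ Γ') × (D ≈ T)

bit : Bool → ℤ
bit true  = + 1
bit false = + 0

dot : ∀ {n} → Vec ℤ n → Vec Bool n → ℤ
dot []       []       = + 0
dot (a ∷ as) (b ∷ bs) = (a ℤ.* bit b) ℤ.+ dot as bs

cube : (n : ℕ) → List (Vec Bool n)
cube zero    = [] ∷ []
cube (suc n) = map (true ∷_) (cube n) ++ map (false ∷_) (cube n)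

valueDisj : ∀ {n} → Vec ℤ n → Disj n
valueDisj a = map (λ x → a ≐ dot a x) (cube _)

SameCoeffs : ∀ {n} → Disj n → Set
SameCoeffs {n} P = Σ (Vec ℤ n) λ v → All (λ e → coeffs e ≡ v) P

TranslatedClause : ∀ {n} → Disj n → Set
TranslatedClause {n} P =
  All (λ e → Σ (Fin n) λ h → (e ≡ (unit h ≐ + 1)) ⊎ (e ≡ (unit h ≐ + 0))) P

R0Line : ∀ {n} → ℕ → ℕ → Disj n → Set
R0Line {n} C K D =
  (∀ e → e ∈ D → ∀ i → ∣ lookup (coeffs e) i ∣ ≤ C) ×
  (Σ (List (Disj n)) λ Ps → (length Ps ≤ K) × (D ↭ concat Ps) ×
     All (λ P → SameCoeffs P ⊎ TranslatedClause P) Ps)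

-- Let pₖ·x = a₁x₁ + ⋯ + aₖxₖ, so p₀ = 0 and pₙ = a. We derive, for k = 0, …, n, the
-- disjunction ⋁_{β ∈ Vₖ} (pₖ·x = β), where Vₖ is the set of values pₖ attains on {0,1}ⁿ.
-- To pass from pₖ to pₖ₊₁ = pₖ + c·xᵢ we first derive c·xᵢ = 0 ∨ xᵢ = 1 and c·xᵢ = c ∨ xᵢ = 0
-- from the Boolean axiom by |c| resolutions each. Then, one disjunct pₖ·x = α at a time,
-- adding these two lines to it gives pₖ₊₁·x = α ∨ xᵢ = 1 and pₖ₊₁·x = α + c ∨ xᵢ = 0, and
-- subtracting the results produces 0 = 1, which simplification removes. A step costs
-- O(|c|·Σ|aⱼ|) lines and zero coefficients cost nothing, so there are O((Σ|aⱼ|)²) lines.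
-- Every line is made of at most three blocks of O(Σ|aⱼ|) equations sharing one coefficient
-- vector, each of size O(Σ|aⱼ|); this bounds the size and makes all lines R⁰(lin)-lines
-- when the aⱼ are bounded.

module Submission where

open import Defs
open import Algebra.Bundles using (IdempotentCommutativeMonoid; CommutativeMonoid)
import Algebra.Solver.IdempotentCommutativeMonoid
open import Data.Bool using (Bool; true; false; not)
open import Data.Fin using (Fin; zero; suc; fromℕ<)
open import Data.Integer as ℤ using (ℤ; ∣_∣; 0ℤ; 1ℤ)
import Data.Integer.Properties as ℤP
open import Data.Integer.Tactic.RingSolver using (solve-∀)
open import Data.List using (List; []; _∷_; _++_; _ʳ++_; map; length; filter; concat)
import Data.List.Properties as ListP
open import Data.List.Membership.Propositional using (_∈_; lose)
open import Data.List.Membership.Propositional.Properties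
  using (∈-++⁺ˡ; ∈-++⁺ʳ; ∈-map⁺; ∈-map⁻; ∈-concat⁻′; ∈-filter⁺; ∈-filter⁻)
open import Data.List.Relation.Binary.BagAndSetEquality using (_∼[_]_; set; commutativeMonoid; ++-idempotent)
open import Data.List.Relation.Binary.Permutation.Propositional using (↭-refl; ↭-sym; ↭-trans)
open import Data.List.Relation.Binary.Permutation.Propositional.Properties using (∈-resp-↭; ++↭ʳ++; ∷↭∷ʳ)
open import Data.List.Relation.Binary.Subset.Propositional using (_⊆_)
open import Data.List.Relation.Unary.All as All using (All; []; _∷_)
import Data.List.Relation.Unary.All.Properties as AllP
open import Data.List.Relation.Unary.Any as Any using (Any; here; there; any?)
open import Data.Nat using (ℕ; zero; suc; _≤_; _<_; z≤n; s≤s; _+_; _*_; _^_)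
import Data.Nat.Properties as ℕP
open import Data.Nat.ListAction using (sum)
open import Data.Nat.Tactic.RingSolver using () renaming (solve-∀ to solve-ℕ)
open import Data.Product using (Σ; ∃; ∃₂; _×_; _,_; proj₁; proj₂)
open import Data.Sum using (inj₁)
open import Data.Vec as Vec using (Vec; []; _∷_; replicate; zipWith; lookup; _[_]≔_)
import Data.Vec.Properties as VecP
open import Function using (_∘_; Equivalence)
open import Relation.Binary.PropositionalEquality
open import Relation.Nullary using (Dec; yes; no)

private variable n : ℕ

scale : ℤ → Vec ℤ n → Vec ℤ n
scale d = Vec.map (d ℤ.*_)

zeros : ∀ n → Vec ℤ n
zeros n = replicate n 0ℤ

scaledEq : ℤ → LinEq n → LinEq n
scaledEq d (v ≐ β) = scale d v ≐ d ℤ.* β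

zipWith-scale-self : ∀ (_∙_ : ℤ → ℤ → ℤ) d → (∀ x → (d ℤ.* x) ∙ x ≡ (d ∙ 1ℤ) ℤ.* x) →
                     (v : Vec ℤ n) → zipWith _∙_ (scale d v) v ≡ scale (d ∙ 1ℤ) v
zipWith-scale-self _∙_ d law []      = refl
zipWith-scale-self _∙_ d law (x ∷ v) = cong₂ _∷_ (law x) (zipWith-scale-self _∙_ d law v)

scaledEq-⊕ : ∀ d (E : LinEq n) → scaledEq d E ⊕ E ≡ scaledEq (d ℤ.+ 1ℤ) E
scaledEq-⊕ d (v ≐ β) = cong₂ _≐_ (zipWith-scale-self ℤ._+_ d (law d) v) (law d β)
  where law : ∀ d x → d ℤ.* x ℤ.+ x ≡ (d ℤ.+ 1ℤ) ℤ.* x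
        law = solve-∀

scaledEq-⊖ : ∀ d (E : LinEq n) → scaledEq d E ⊖ E ≡ scaledEq (d ℤ.- 1ℤ) E
scaledEq-⊖ d (v ≐ β) = cong₂ _≐_ (zipWith-scale-self ℤ._-_ d (law d) v) (law d β)
  where law : ∀ d x → d ℤ.* x ℤ.- x ≡ (d ℤ.- 1ℤ) ℤ.* x
        law = solve-∀

zipWith-minus-self : (v : Vec ℤ n) → zipWith ℤ._-_ v v ≡ zeros n
zipWith-minus-self []      = refl
zipWith-minus-self (x ∷ v) = cong₂ _∷_ (ℤP.+-inverseʳ x) (zipWith-minus-self v)

scale-zero : (v : Vec ℤ n) → scale 0ℤ v ≡ zeros n
scale-zero v = VecP.map-const v 0ℤ

scale-zeros : ∀ d n → scale d (zeros n) ≡ zeros n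
scale-zeros d n = trans (VecP.map-replicate (d ℤ.*_) 0ℤ n) (cong (replicate n) (ℤP.*-zeroʳ d))

⊖-self : (E : LinEq n) → E ⊖ E ≡ scaledEq 0ℤ E
⊖-self (v ≐ β) = cong₂ _≐_ (trans (zipWith-minus-self v) (sym (scale-zero v))) (ℤP.+-inverseʳ β)

zipWith-+-zeros : (v : Vec ℤ n) → zipWith ℤ._+_ v (zeros n) ≡ v
zipWith-+-zeros []      = refl
zipWith-+-zeros (x ∷ v) = cong₂ _∷_ (ℤP.+-identityʳ x) (zipWith-+-zeros v)

addTerm : Vec ℤ n → ℤ → Fin n → Vec ℤ n
addTerm p c i = zipWith ℤ._+_ p (scale c (unit i))

addTerm-zero : ∀ (p : Vec ℤ n) i → addTerm p 0ℤ i ≡ p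
addTerm-zero p i = trans (cong (zipWith ℤ._+_ p) (scale-zero (unit i))) (zipWith-+-zeros p)

BoundedBy : ℕ → Vec ℤ n → Set
BoundedBy B v = ∀ j → ∣ lookup v j ∣ ≤ B

coeffSize-zeros : ∀ n → coeffSize (zeros n) ≡ 0
coeffSize-zeros zero    = refl
coeffSize-zeros (suc n) = coeffSize-zeros n

coeffSize-unit : (i : Fin n) → coeffSize (unit i) ≡ 1
coeffSize-unit {suc n} zero    = cong suc (coeffSize-zeros n)
coeffSize-unit         (suc i) = coeffSize-unit i

coeffSize-scale : ∀ d (v : Vec ℤ n) → coeffSize (scale d v) ≡ ∣ d ∣ * coeffSize v
coeffSize-scale d []      = sym (ℕP.*-zeroʳ ∣ d ∣)
coeffSize-scale d (x ∷ v) = begin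
  ∣ d ℤ.* x ∣ + coeffSize (scale d v)     ≡⟨ cong₂ _+_ (ℤP.∣i*j∣≡∣i∣*∣j∣ d x) (coeffSize-scale d v) ⟩
  ∣ d ∣ * ∣ x ∣ + ∣ d ∣ * coeffSize v     ≡⟨ ℕP.*-distribˡ-+ ∣ d ∣ ∣ x ∣ (coeffSize v) ⟨
  ∣ d ∣ * (∣ x ∣ + coeffSize v)           ∎
  where open ≡-Reasoning

coeffSize-scale-unit : ∀ d (i : Fin n) → coeffSize (scale d (unit i)) ≡ ∣ d ∣
coeffSize-scale-unit d i = trans (coeffSize-scale d (unit i)) (trans (cong (∣ d ∣ *_) (coeffSize-unit i)) (ℕP.*-identityʳ _))

∣lookup∣≤coeffSize : (v : Vec ℤ n) (j : Fin n) → ∣ lookup v j ∣ ≤ coeffSize v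
∣lookup∣≤coeffSize (x ∷ v) zero    = ℕP.m≤m+n _ _
∣lookup∣≤coeffSize (x ∷ v) (suc j) = ℕP.≤-trans (∣lookup∣≤coeffSize v j) (ℕP.m≤n+m _ ∣ x ∣)

zeros-bounded : ∀ n B → BoundedBy B (zeros n)
zeros-bounded n B j = ℕP.≤-trans (ℕP.≤-reflexive (cong ∣_∣ (VecP.lookup-replicate j 0ℤ))) z≤n

scale-unit-bounded : ∀ d (i : Fin n) → BoundedBy ∣ d ∣ (scale d (unit i))
scale-unit-bounded d i j = ℕP.≤-trans (∣lookup∣≤coeffSize (scale d (unit i)) j) (ℕP.≤-reflexive (coeffSize-scale-unit d i))

unit-bounded : (i : Fin n) → BoundedBy 1 (unit i)
unit-bounded i j = ℕP.≤-trans (∣lookup∣≤coeffSize (unit i) j) (ℕP.≤-reflexive (coeffSize-unit i))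

dot-zipWith-+ : (v w : Vec ℤ n) (x : Vec Bool n) → dot (zipWith ℤ._+_ v w) x ≡ dot v x ℤ.+ dot w x
dot-zipWith-+ []       []       []      = refl
dot-zipWith-+ (v ∷ vs) (w ∷ ws) (b ∷ x) =
  trans (cong (ℤ._+_ ((v ℤ.+ w) ℤ.* bit b)) (dot-zipWith-+ vs ws x)) (regroup v w (bit b) (dot vs x) (dot ws x))
  where regroup : ∀ v w b d e → (v ℤ.+ w) ℤ.* b ℤ.+ (d ℤ.+ e) ≡ (v ℤ.* b ℤ.+ d) ℤ.+ (w ℤ.* b ℤ.+ e)
        regroup = solve-∀

dot-scale : ∀ d (v : Vec ℤ n) (x : Vec Bool n) → dot (scale d v) x ≡ d ℤ.* dot v x
dot-scale d []       []      = sym (ℤP.*-zeroʳ d)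
dot-scale d (v ∷ vs) (b ∷ x) =
  trans (cong (ℤ._+_ (d ℤ.* v ℤ.* bit b)) (dot-scale d vs x)) (factor d v (bit b) (dot vs x))
  where factor : ∀ d v b e → d ℤ.* v ℤ.* b ℤ.+ d ℤ.* e ≡ d ℤ.* (v ℤ.* b ℤ.+ e)
        factor = solve-∀

dot-zeros : (x : Vec Bool n) → dot (zeros n) x ≡ 0ℤ
dot-zeros []      = refl
dot-zeros (b ∷ x) = trans (ℤP.+-identityˡ _) (dot-zeros x)

dot-unit : (i : Fin n) (x : Vec Bool n) → dot (unit i) x ≡ bit (lookup x i)
dot-unit zero    (b ∷ x) = trans (cong (ℤ._+_ (1ℤ ℤ.* bit b)) (dot-zeros x))
                                 (trans (ℤP.+-identityʳ _) (ℤP.*-identityˡ (bit b)))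
dot-unit (suc i) (b ∷ x) = trans (ℤP.+-identityˡ _) (dot-unit i x)

dot-update : (v : Vec ℤ n) (i : Fin n) (x : Vec Bool n) (b : Bool) →
             lookup v i ≡ 0ℤ → dot v (x [ i ]≔ b) ≡ dot v x
dot-update (v ∷ vs) zero    (c ∷ x) b refl = refl
dot-update (v ∷ vs) (suc i) (c ∷ x) b vᵢ≡0 = cong (ℤ._+_ (v ℤ.* bit c)) (dot-update vs i x b vᵢ≡0)

dot-addTerm : ∀ (p : Vec ℤ n) c i x → dot (addTerm p c i) x ≡ dot p x ℤ.+ c ℤ.* bit (lookup x i)
dot-addTerm p c i x = begin
  dot (addTerm p c i) x                   ≡⟨ dot-zipWith-+ p (scale c (unit i)) x ⟩
  dot p x ℤ.+ dot (scale c (unit i)) x    ≡⟨ cong (ℤ._+_ (dot p x)) (dot-scale c (unit i) x) ⟩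
  dot p x ℤ.+ c ℤ.* dot (unit i) x        ≡⟨ cong (λ y → dot p x ℤ.+ c ℤ.* y) (dot-unit i x) ⟩
  dot p x ℤ.+ c ℤ.* bit (lookup x i)      ∎
  where open ≡-Reasoning

∣bit∣≤1 : ∀ b → ∣ bit b ∣ ≤ 1
∣bit∣≤1 true  = ℕP.≤-refl
∣bit∣≤1 false = z≤n

∣*bit∣≤ : ∀ d b → ∣ d ℤ.* bit b ∣ ≤ ∣ d ∣
∣*bit∣≤ d b = begin
  ∣ d ℤ.* bit b ∣    ≡⟨ ℤP.∣i*j∣≡∣i∣*∣j∣ d (bit b) ⟩
  ∣ d ∣ * ∣ bit b ∣  ≤⟨ ℕP.*-monoʳ-≤ ∣ d ∣ (∣bit∣≤1 b) ⟩
  ∣ d ∣ * 1          ≡⟨ ℕP.*-identityʳ ∣ d ∣ ⟩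
  ∣ d ∣              ∎
  where open ℕP.≤-Reasoning

∣dot∣≤coeffSize : (v : Vec ℤ n) (x : Vec Bool n) → ∣ dot v x ∣ ≤ coeffSize v
∣dot∣≤coeffSize []       []      = z≤n
∣dot∣≤coeffSize (v ∷ vs) (b ∷ x) =
  ℕP.≤-trans (ℤP.∣i+j∣≤∣i∣+∣j∣ (v ℤ.* bit b) (dot vs x)) (ℕP.+-mono-≤ (∣*bit∣≤ v b) (∣dot∣≤coeffSize vs x))

∈-cube : (x : Vec Bool n) → x ∈ cube n
∈-cube []          = here refl
∈-cube (true ∷ x)  = ∈-++⁺ˡ (∈-map⁺ (true ∷_) (∈-cube x))
∈-cube (false ∷ x) = ∈-++⁺ʳ _ (∈-map⁺ (false ∷_) (∈-cube x))

prefix : ℕ → Vec ℤ n → Vec ℤ n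
prefix k       []      = []
prefix zero    (x ∷ v) = 0ℤ ∷ prefix zero v
prefix (suc k) (x ∷ v) = x ∷ prefix k v

prefix-zero : (v : Vec ℤ n) → prefix 0 v ≡ zeros n
prefix-zero []      = refl
prefix-zero (x ∷ v) = cong (0ℤ ∷_) (prefix-zero v)

dot-prefix-zero : (v : Vec ℤ n) (x : Vec Bool n) → dot (prefix 0 v) x ≡ 0ℤ
dot-prefix-zero v x = trans (cong (λ w → dot w x) (prefix-zero v)) (dot-zeros x)

prefix-full : (v : Vec ℤ n) → prefix n v ≡ v
prefix-full []      = refl
prefix-full (x ∷ v) = cong (x ∷_) (prefix-full v)

lookup-prefix : ∀ k (k<n : k < n) (v : Vec ℤ n) → lookup (prefix k v) (fromℕ< k<n) ≡ 0ℤ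
lookup-prefix zero    (s≤s _)   (x ∷ v) = refl
lookup-prefix (suc k) (s≤s k<n) (x ∷ v) = lookup-prefix k k<n v

prefix-suc : ∀ k (k<n : k < n) (v : Vec ℤ n) → let i = fromℕ< k<n in
             prefix (suc k) v ≡ addTerm (prefix k v) (lookup v i) i
prefix-suc {suc n} zero (s≤s _) (x ∷ v) = cong₂ _∷_ (sym x≡) (sym (begin
  zipWith ℤ._+_ (prefix 0 v) (scale x (zeros n))  ≡⟨ cong₂ (zipWith ℤ._+_) (prefix-zero v) (scale-zeros x n) ⟩
  zipWith ℤ._+_ (zeros n) (zeros n)                ≡⟨ zipWith-+-zeros (zeros n) ⟩
  zeros n                                          ≡⟨ prefix-zero v ⟨
  prefix 0 v                                       ∎))
  where
    open ≡-Reasoning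
    x≡ : 0ℤ ℤ.+ x ℤ.* 1ℤ ≡ x
    x≡ = trans (ℤP.+-identityˡ _) (ℤP.*-identityʳ x)
prefix-suc (suc k) (s≤s k<n) (x ∷ v) = cong₂ _∷_ (sym x≡) (prefix-suc k k<n v)
  where
    x≡ : x ℤ.+ lookup v (fromℕ< k<n) ℤ.* 0ℤ ≡ x
    x≡ = trans (cong (ℤ._+_ x) (ℤP.*-zeroʳ (lookup v (fromℕ< k<n)))) (ℤP.+-identityʳ x)

prefix-suc-zero : ∀ k (k<n : k < n) (v : Vec ℤ n) → lookup v (fromℕ< k<n) ≡ 0ℤ →
                  prefix (suc k) v ≡ prefix k v
prefix-suc-zero k k<n v vₖ≡0 =
  trans (prefix-suc k k<n v) (trans (cong (λ c → addTerm (prefix k v) c _) vₖ≡0) (addTerm-zero (prefix k v) _))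

coeffSize-prefix-suc : ∀ k (k<n : k < n) (v : Vec ℤ n) →
                       coeffSize (prefix (suc k) v) ≡ ∣ lookup v (fromℕ< k<n) ∣ + coeffSize (prefix k v)
coeffSize-prefix-suc zero    (s≤s _)   (x ∷ v) = refl
coeffSize-prefix-suc (suc k) (s≤s k<n) (x ∷ v) = begin
  ∣ x ∣ + coeffSize (prefix (suc k) v)             ≡⟨ cong (∣ x ∣ +_) (coeffSize-prefix-suc k k<n v) ⟩
  ∣ x ∣ + (∣ y ∣ + coeffSize (prefix k v))         ≡⟨ ℕP.+-assoc ∣ x ∣ ∣ y ∣ _ ⟨
  (∣ x ∣ + ∣ y ∣) + coeffSize (prefix k v)         ≡⟨ cong (_+ coeffSize (prefix k v)) (ℕP.+-comm ∣ x ∣ ∣ y ∣) ⟩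
  (∣ y ∣ + ∣ x ∣) + coeffSize (prefix k v)         ≡⟨ ℕP.+-assoc ∣ y ∣ ∣ x ∣ _ ⟩
  ∣ y ∣ + (∣ x ∣ + coeffSize (prefix k v))         ∎
  where open ≡-Reasoning
        y = lookup v (fromℕ< k<n)

coeffSize-prefix : ∀ k (v : Vec ℤ n) → coeffSize (prefix k v) ≤ coeffSize v
coeffSize-prefix k       []      = z≤n
coeffSize-prefix zero    (x ∷ v) = ℕP.≤-trans (coeffSize-prefix zero v) (ℕP.m≤n+m _ ∣ x ∣)
coeffSize-prefix (suc k) (x ∷ v) = ℕP.+-monoʳ-≤ ∣ x ∣ (coeffSize-prefix k v)

prefix-bounded : ∀ {B} k (v : Vec ℤ n) → BoundedBy B v → BoundedBy B (prefix k v)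
prefix-bounded zero    (x ∷ v) v≤B zero    = z≤n
prefix-bounded zero    (x ∷ v) v≤B (suc j) = prefix-bounded zero v (v≤B ∘ suc) j
prefix-bounded (suc k) (x ∷ v) v≤B zero    = v≤B zero
prefix-bounded (suc k) (x ∷ v) v≤B (suc j) = prefix-bounded k v (v≤B ∘ suc) j

-- Attained values

interval : ℕ → List ℤ
interval zero    = 0ℤ ∷ []
interval (suc s) = ℤ.+ suc s ∷ ℤ.-[1+ s ] ∷ interval s

∈-interval⁺ : ∀ s {β} → ∣ β ∣ ≤ s → β ∈ interval s
∈-interval⁺ zero    {ℤ.+ zero}  _ = here refl
∈-interval⁺ (suc s) {ℤ.+ m} m≤1+s with m ℕP.≟ suc s
... | yes refl = here refl
... | no  m≢1+s = there (there (∈-interval⁺ s (ℕP.≤-pred (ℕP.≤∧≢⇒< m≤1+s m≢1+s))))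
∈-interval⁺ (suc s) {ℤ.-[1+ m ]} 1+m≤1+s with m ℕP.≟ s
... | yes refl = there (here refl)
... | no  m≢s  = there (there (∈-interval⁺ s (ℕP.≤∧≢⇒< (ℕP.≤-pred 1+m≤1+s) m≢s)))

∈-interval⁻ : ∀ s {β} → β ∈ interval s → ∣ β ∣ ≤ s
∈-interval⁻ zero    (here refl)         = z≤n
∈-interval⁻ (suc s) (here refl)         = ℕP.≤-refl
∈-interval⁻ (suc s) (there (here refl)) = ℕP.≤-refl
∈-interval⁻ (suc s) (there (there β∈))  = ℕP.m≤n⇒m≤1+n (∈-interval⁻ s β∈)

length-interval : ∀ s → length (interval s) ≡ suc (s + s)
length-interval zero    = refl
length-interval (suc s) = cong (λ m → suc (suc m)) (trans (length-interval s) (sym (ℕP.+-suc s s)))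

attains? : (v : Vec ℤ n) (β : ℤ) → Dec (Any (λ x → dot v x ≡ β) (cube n))
attains? v β = any? (λ x → dot v x ℤ.≟ β) (cube _)

-- Filtering the interval [-s, s], rather than listing v·x over the cube, keeps the list short.
values : ℕ → Vec ℤ n → List ℤ
values s v = filter (attains? v) (interval s)

∈-values⁻ : ∀ s (v : Vec ℤ n) {β} → β ∈ values s v → ∣ β ∣ ≤ s × ∃ λ x → dot v x ≡ β
∈-values⁻ s v β∈ with β∈interval , attained ← ∈-filter⁻ (attains? v) {xs = interval s} β∈ =
  ∈-interval⁻ s β∈interval , Any.satisfied attained

∈-values⁺ : ∀ s (v : Vec ℤ n) → coeffSize v ≤ s → ∀ x → dot v x ∈ values s v
∈-values⁺ s v v≤s x = ∈-filter⁺ (attains? v) (∈-interval⁺ s (ℕP.≤-trans (∣dot∣≤coeffSize v x) v≤s)) (lose (∈-cube x) refl)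

length-values : ∀ s (v : Vec ℤ n) → length (values s v) ≤ suc (s + s)
length-values s v = ℕP.≤-trans (ListP.length-filter (attains? v) (interval s)) (ℕP.≤-reflexive (length-interval s))

values-bounded : ∀ s (v : Vec ℤ n) → All (λ β → ∣ β ∣ ≤ s) (values s v)
values-bounded s v = All.tabulate (proj₁ ∘ ∈-values⁻ s v)

values-nonempty : ∀ s (v : Vec ℤ n) → coeffSize v ≤ s → ∃₂ λ α L → values s v ≡ α ∷ L
values-nonempty s v v≤s with values s v | ∈-values⁺ s v v≤s (replicate _ false)
... | α ∷ L | _ = α , L , refl

values≈valueDisj : (v : Vec ℤ n) → map (v ≐_) (values (coeffSize v) v) ≈ valueDisj v
values≈valueDisj v e = to , from
  where
    to : e ∈ map (v ≐_) (values (coeffSize v) v) → e ∈ valueDisj v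
    to e∈ with β , β∈ , refl ← ∈-map⁻ (v ≐_) e∈ with _ , x , refl ← ∈-values⁻ (coeffSize v) v β∈ =
      ∈-map⁺ (λ x → v ≐ dot v x) (∈-cube x)
    from : e ∈ valueDisj v → e ∈ map (v ≐_) (values (coeffSize v) v)
    from e∈ with x , _ , refl ← ∈-map⁻ (λ x → v ≐ dot v x) e∈ = ∈-map⁺ (v ≐_) (∈-values⁺ (coeffSize v) v ℕP.≤-refl x)

shifted : ℤ → List ℤ → List ℤ
shifted c []      = []
shifted c (α ∷ L) = α ℤ.+ c ℤ.* bit false ∷ α ℤ.+ c ℤ.* bit true ∷ shifted c L

∈-shifted⁺ : ∀ c {L α} → α ∈ L → ∀ b → α ℤ.+ c ℤ.* bit b ∈ shifted c L
∈-shifted⁺ c (here refl) false = here refl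
∈-shifted⁺ c (here refl) true  = there (here refl)
∈-shifted⁺ c (there α∈)  b     = there (there (∈-shifted⁺ c α∈ b))

∈-shifted⁻ : ∀ c L {β} → β ∈ shifted c L → ∃₂ λ α b → α ∈ L × β ≡ α ℤ.+ c ℤ.* bit b
∈-shifted⁻ c (α ∷ L) (here refl)         = α , false , here refl , refl
∈-shifted⁻ c (α ∷ L) (there (here refl)) = α , true , here refl , refl
∈-shifted⁻ c (α ∷ L) (there (there β∈)) with α′ , b , α′∈ , refl ← ∈-shifted⁻ c L β∈ = α′ , b , there α′∈ , refl

shifted-mono : ∀ c {L M} → (∀ {α} → α ∈ L → α ∈ M) → ∀ {β} → β ∈ shifted c L → β ∈ shifted c M
shifted-mono c {L} L⊆M β∈ with _ , b , α∈ , refl ← ∈-shifted⁻ c L β∈ = ∈-shifted⁺ c (L⊆M α∈) b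

length-shifted : ∀ c L → length (shifted c L) ≡ length L + length L
length-shifted c []      = refl
length-shifted c (α ∷ L) = cong suc (trans (cong suc (length-shifted c L)) (sym (ℕP.+-suc _ _)))

∣+*bit∣≤ : ∀ {s} α c b → ∣ α ∣ ≤ s → ∣ c ∣ ≤ s → ∣ α ℤ.+ c ℤ.* bit b ∣ ≤ s + s
∣+*bit∣≤ α c b α≤s c≤s =
  ℕP.≤-trans (ℤP.∣i+j∣≤∣i∣+∣j∣ α (c ℤ.* bit b)) (ℕP.+-mono-≤ α≤s (ℕP.≤-trans (∣*bit∣≤ c b) c≤s))

shifted-bounded : ∀ {s} c L → ∣ c ∣ ≤ s → All (λ β → ∣ β ∣ ≤ s) L → All (λ β → ∣ β ∣ ≤ s + s) (shifted c L)
shifted-bounded c []      c≤s []           = []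
shifted-bounded c (α ∷ L) c≤s (α≤s ∷ L≤s) =
  ∣+*bit∣≤ α c false α≤s c≤s ∷ ∣+*bit∣≤ α c true α≤s c≤s ∷ shifted-bounded c L c≤s L≤s

module _ (s : ℕ) (p : Vec ℤ n) (c : ℤ) (i : Fin n) where

  values-addTerm⁻ : coeffSize p ≤ s → ∀ {β} → β ∈ values s (addTerm p c i) → β ∈ shifted c (values s p)
  values-addTerm⁻ p≤s β∈ with _ , x , refl ← ∈-values⁻ s (addTerm p c i) β∈ =
    subst (_∈ shifted c (values s p)) (sym (dot-addTerm p c i x))
          (∈-shifted⁺ c (∈-values⁺ s p p≤s x) (lookup x i))

  values-addTerm⁺ : lookup p i ≡ 0ℤ → coeffSize (addTerm p c i) ≤ s →
                    ∀ {β} → β ∈ shifted c (values s p) → β ∈ values s (addTerm p c i)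
  values-addTerm⁺ pᵢ≡0 p′≤s β∈ with α , b , α∈ , refl ← ∈-shifted⁻ c (values s p) β∈
                               with _ , x , refl ← ∈-values⁻ s p α∈ =
    subst (_∈ values s (addTerm p c i)) eq (∈-values⁺ s (addTerm p c i) p′≤s (x [ i ]≔ b))
    where
      eq : dot (addTerm p c i) (x [ i ]≔ b) ≡ dot p x ℤ.+ c ℤ.* bit b
      eq = begin
        dot (addTerm p c i) (x [ i ]≔ b)                            ≡⟨ dot-addTerm p c i _ ⟩
        dot p (x [ i ]≔ b) ℤ.+ c ℤ.* bit (lookup (x [ i ]≔ b) i)    ≡⟨ cong₂ (λ y b′ → y ℤ.+ c ℤ.* bit b′)
                                                                         (dot-update p i x b pᵢ≡0) (VecP.lookup∘update i x b) ⟩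
        dot p x ℤ.+ c ℤ.* bit b                                     ∎
        where open ≡-Reasoning

module _ {n : ℕ} where

  ≈-refl : {A : Disj n} → A ≈ A
  ≈-refl e = (λ e∈ → e∈) , (λ e∈ → e∈)

  ≈-trans : {A B C : Disj n} → A ≈ B → B ≈ C → A ≈ C
  ≈-trans A≈B B≈C e = proj₁ (B≈C e) ∘ proj₁ (A≈B e) , proj₂ (A≈B e) ∘ proj₂ (B≈C e)

  ≈-reflexive : {A B : Disj n} → A ≡ B → A ≈ B
  ≈-reflexive refl = ≈-refl

  ∼⇒≈ : {A B : Disj n} → A ∼[ set ] B → A ≈ B
  ∼⇒≈ A∼B e = Equivalence.to A∼B , Equivalence.from A∼B

  ≐-cong : ∀ (v : Vec ℤ n) {L M} → (∀ {β} → β ∈ L → β ∈ M) → (∀ {β} → β ∈ M → β ∈ L) → map (v ≐_) L ≈ map (v ≐_) M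
  ≐-cong v L⊆M M⊆L e = transport L⊆M , transport M⊆L
    where transport : ∀ {L M} → (∀ {β} → β ∈ L → β ∈ M) → e ∈ map (v ≐_) L → e ∈ map (v ≐_) M
          transport L⊆M e∈ with β , β∈ , refl ← ∈-map⁻ (v ≐_) e∈ = ∈-map⁺ (v ≐_) (L⊆M β∈)

  setMonoid : IdempotentCommutativeMonoid _ _
  setMonoid = record
    { isIdempotentCommutativeMonoid = record
      { isCommutativeMonoid = CommutativeMonoid.isCommutativeMonoid (commutativeMonoid set (LinEq n))
      ; idem                = ++-idempotent
      }
    }

  -- Decides set equality of ++-combinations of disjunctions, i.e. equality up to
  -- reordering and duplication of the pieces.
  module ByArrangement = Algebra.Solver.IdempotentCommutativeMonoid setMonoid

  infix 4 _∋≈_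

  _∋≈_ : List (Disj n) → Disj n → Set
  Γ ∋≈ X = ∃ λ P → P ∈ Γ × P ≈ X

  here≈ : ∀ {P Γ X} → P ≈ X → P ∷ Γ ∋≈ X
  here≈ P≈X = _ , here refl , P≈X

  ∋≈-⊆ : ∀ {Γ Γ′ X} → Γ ⊆ Γ′ → Γ ∋≈ X → Γ′ ∋≈ X
  ∋≈-⊆ Γ⊆Γ′ (P , P∈ , P≈X) = P , Γ⊆Γ′ P∈ , P≈X

  resolve⁺ : ∀ {Γ X Y D} L₁ L₂ A B → Γ ∋≈ X → Γ ∋≈ Y → X ≈ (L₁ ∷ A) → Y ≈ (L₂ ∷ B) →
             D ≈ ((L₁ ⊕ L₂) ∷ (A ++ B)) → Rule Γ D
  resolve⁺ L₁ L₂ A B (_ , P∈ , P≈X) (_ , Q∈ , Q≈Y) X≈ Y≈ = resol+ A B L₁ L₂ P∈ Q∈ (≈-trans P≈X X≈) (≈-trans Q≈Y Y≈)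

  resolve⁻ : ∀ {Γ X Y D} L₁ L₂ A B → Γ ∋≈ X → Γ ∋≈ Y → X ≈ (L₁ ∷ A) → Y ≈ (L₂ ∷ B) →
             D ≈ ((L₁ ⊖ L₂) ∷ (A ++ B)) → Rule Γ D
  resolve⁻ L₁ L₂ A B (_ , P∈ , P≈X) (_ , Q∈ , Q≈Y) X≈ Y≈ = resol- A B L₁ L₂ P∈ Q∈ (≈-trans P≈X X≈) (≈-trans Q≈Y Y≈)

  simplify : ∀ {Γ D} → Γ ∋≈ zeroEq 1ℤ ∷ D → Rule Γ D
  simplify (_ , P∈ , P≈) = simp 1ℤ (λ ()) P∈ P≈

-- Derivations whose lines satisfy an invariant

module Extensions {n : ℕ} (Good : Disj n → Set) where

  record GoodDerivation (Γ : List (Disj n)) : Set where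
    constructor _,_
    field
      derivation : Derivation Γ
      allGood    : All Good Γ

  record Extension (Γ : List (Disj n)) (N : ℕ) (Y : Disj n) : Set where
    field
      {last}    : Disj n
      {earlier} : List (Disj n)
      good      : GoodDerivation (last ∷ earlier)
      extends   : Γ ⊆ last ∷ earlier
      length≤   : length (last ∷ earlier) ≤ N + length Γ
      last≈     : last ≈ Y

  infer : ∀ {Γ D} → GoodDerivation Γ → Rule Γ D → Good D → Extension Γ 1 D
  infer (d , g) r gD =
    record { good = (_ ∷⟨ r ⟩ d) , (gD ∷ g) ; extends = there ; length≤ = ℕP.≤-refl ; last≈ = ≈-refl }

  stay : ∀ {P Γ Y} → GoodDerivation (P ∷ Γ) → P ≈ Y → Extension (P ∷ Γ) 0 Y
  stay g P≈Y = record { good = g ; extends = λ e∈ → e∈ ; length≤ = ℕP.≤-refl ; last≈ = P≈Y }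

  Continuation : List (Disj n) → ℕ → Disj n → Disj n → Set
  Continuation Γ N X Y = ∀ {P Γ₁} → GoodDerivation (P ∷ Γ₁) → Γ ⊆ P ∷ Γ₁ → P ≈ X → Extension (P ∷ Γ₁) N Y

  _>>=_ : ∀ {Γ N₁ N₂ X Y} → Extension Γ N₁ X → Continuation Γ N₂ X Y → Extension Γ (N₂ + N₁) Y
  _>>=_ {Γ} {N₁} {N₂} e k = record
    { good    = E′.good
    ; extends = E′.extends ∘ E.extends
    ; length≤ = begin
        length (E′.last ∷ E′.earlier)    ≤⟨ E′.length≤ ⟩
        N₂ + length (E.last ∷ E.earlier) ≤⟨ ℕP.+-monoʳ-≤ N₂ E.length≤ ⟩
        N₂ + (N₁ + length Γ)             ≡⟨ ℕP.+-assoc N₂ N₁ (length Γ) ⟨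
        N₂ + N₁ + length Γ               ∎
    ; last≈   = E′.last≈
    }
    where
      module E = Extension e
      module E′ = Extension (k E.good E.extends E.last≈)
      open ℕP.≤-Reasoning

  retarget : ∀ {Γ N Y Y′} → Y ≈ Y′ → Extension Γ N Y → Extension Γ N Y′
  retarget Y≈Y′ e = record { Extension e ; last≈ = ≈-trans (Extension.last≈ e) Y≈Y′ }

  weaken : ∀ {Γ N M Y} → N ≤ M → Extension Γ N Y → Extension Γ M Y
  weaken N≤M e = record { Extension e ; length≤ = ℕP.≤-trans (Extension.length≤ e) (ℕP.+-monoˡ-≤ _ N≤M) }

sum-map-≤ : ∀ {A : Set} (f : A → ℕ) {M} (xs : List A) → All (λ x → f x ≤ M) xs → sum (map f xs) ≤ length xs * M
sum-map-≤ f []       []           = z≤n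
sum-map-≤ f (x ∷ xs) (fx≤M ∷ ≤M) = ℕP.+-mono-≤ fx≤M (sum-map-≤ f xs ≤M)

-- Blocks of equations with a common coefficient vector

infix 4 _≐∈_

record Block (n : ℕ) : Set where
  constructor _≐∈_
  field
    coeff : Vec ℤ n
    frees : List ℤ
open Block

⟦_⟧ : Block n → Disj n
⟦ v ≐∈ L ⟧ = map (v ≐_) L

⟪_⟫ : List (Block n) → Disj n
⟪ bs ⟫ = concat (map ⟦_⟧ bs)

module GoodLines {n : ℕ} (a : Vec ℤ n) where

  S W : ℕ
  S = coeffSize a
  W = suc (S + S)

  -- Unit vectors have entry 1 even where a vanishes, hence the bound suc B.
  Dominated : Vec ℤ n → Set
  Dominated v = ∀ {B} → BoundedBy B a → BoundedBy (suc B) v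

  record GoodBlock (b : Block n) : Set where
    constructor goodBlock
    field
      coeff≤    : coeffSize (coeff b) ≤ suc S
      dominated : Dominated (coeff b)
      length≤   : length (frees b) ≤ W + W
      frees≤    : All (λ β → ∣ β ∣ ≤ W) (frees b)

  -- A line made of at most three good blocks is an R⁰(lin)-line and has size O(S²).
  data GoodLine : Disj n → Set where
    goodLine : ∀ bs → length bs ≤ 3 → All GoodBlock bs → GoodLine ⟪ bs ⟫

  lineSize : ℕ
  lineSize = 3 * (W + W) * (suc S + W)

  GoodLine⇒disjSize : ∀ {D} → GoodLine D → disjSize D ≤ lineSize
  GoodLine⇒disjSize (goodLine bs bs≤3 good) = begin
    disjSize ⟪ bs ⟫                         ≤⟨ sum-map-≤ eqSize ⟪ bs ⟫ (eqSize≤ bs good) ⟩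
    length ⟪ bs ⟫ * (suc S + W)             ≤⟨ ℕP.*-monoˡ-≤ _ (length≤ bs good) ⟩
    length bs * (W + W) * (suc S + W)       ≤⟨ ℕP.*-monoˡ-≤ _ (ℕP.*-monoˡ-≤ _ bs≤3) ⟩
    lineSize                                ∎
    where
      open ℕP.≤-Reasoning
      eqSize≤ : ∀ bs → All GoodBlock bs → All (λ e → eqSize e ≤ suc S + W) ⟪ bs ⟫
      eqSize≤ []                  []                                = []
      eqSize≤ ((v ≐∈ L) ∷ bs) (goodBlock v≤ _ _ L≤ ∷ good) =
        AllP.++⁺ (AllP.map⁺ (All.map (ℕP.+-mono-≤ v≤) L≤)) (eqSize≤ bs good)
      length≤ : ∀ bs → All GoodBlock bs → length ⟪ bs ⟫ ≤ length bs * (W + W)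
      length≤ []              []                                 = z≤n
      length≤ ((v ≐∈ L) ∷ bs) (goodBlock _ _ L≤ _ ∷ good) = begin
        length (map (v ≐_) L ++ ⟪ bs ⟫)          ≡⟨ ListP.length-++ (map (v ≐_) L) ⟩
        length (map (v ≐_) L) + length ⟪ bs ⟫    ≡⟨ cong (_+ length ⟪ bs ⟫) (ListP.length-map (v ≐_) L) ⟩
        length L + length ⟪ bs ⟫                 ≤⟨ ℕP.+-mono-≤ L≤ (length≤ bs good) ⟩
        (W + W) + length bs * (W + W)            ∎

  GoodLine⇒R0Line : ∀ {B D} → BoundedBy B a → GoodLine D → R0Line (suc B) 3 D
  GoodLine⇒R0Line a≤B (goodLine bs bs≤3 good) =
    coeffs≤ , map ⟦_⟧ bs , ℕP.≤-trans (ℕP.≤-reflexive (ListP.length-map ⟦_⟧ bs)) bs≤3 , ↭-refl ,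
    AllP.map⁺ (All.universal (λ b → inj₁ (coeff b , AllP.map⁺ (All.universal (λ _ → refl) (frees b)))) bs)
    where
      coeffs≤ : ∀ e → e ∈ ⟪ bs ⟫ → BoundedBy (suc _) (coeffs e)
      coeffs≤ e e∈ with _ , e∈⟦b⟧ , ⟦b⟧∈ ← ∈-concat⁻′ (map ⟦_⟧ bs) e∈
                   with b , b∈ , refl ← ∈-map⁻ ⟦_⟧ ⟦b⟧∈
                   with _ , _ , refl ← ∈-map⁻ (coeff b ≐_) e∈⟦b⟧ =
        GoodBlock.dominated (All.lookup good b∈) a≤B

-- The derivation for a fixed linear form

module Construction {n : ℕ} (a : Vec ℤ n) where

  open GoodLines a
  open Extensions GoodLine
  open ByArrangement {n} using (Expr; prove; var) renaming (_⊕_ to _∪_; id to ∅)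

  private
    x₀ : ∀ {m} → Expr (suc m)
    x₀ = var zero
    x₁ : ∀ {m} → Expr (2 + m)
    x₁ = var (suc zero)
    x₂ : ∀ {m} → Expr (3 + m)
    x₂ = var (suc (suc zero))
    x₃ : ∀ {m} → Expr (4 + m)
    x₃ = var (suc (suc (suc zero)))
    x₄ : ∀ {m} → Expr (5 + m)
    x₄ = var (suc (suc (suc (suc zero))))

  swap≈ : (x y : LinEq n) → (x ∷ y ∷ []) ≈ (y ∷ x ∷ [])
  swap≈ x y = ∼⇒≈ (prove 2 (x₀ ∪ x₁) (x₁ ∪ x₀) ((x ∷ []) ∷ (y ∷ []) ∷ []))

  S≤W : S ≤ W
  S≤W = ℕP.≤-trans (ℕP.m≤m+n S S) (ℕP.n≤1+n _)

  singleton≤ : 1 ≤ W + W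
  singleton≤ = s≤s z≤n

  unitBlock : ∀ i {γ} → ∣ γ ∣ ≤ 1 → GoodBlock (unit i ≐∈ γ ∷ [])
  unitBlock i γ≤1 = goodBlock (ℕP.≤-trans (ℕP.≤-reflexive (coeffSize-unit i)) (s≤s z≤n))
    (λ _ j → ℕP.≤-trans (unit-bounded i j) (s≤s z≤n)) singleton≤ (ℕP.≤-trans γ≤1 (s≤s z≤n) ∷ [])

  scaledUnitBlock : ∀ i d b → ∣ d ∣ ≤ ∣ lookup a i ∣ → GoodBlock (scale d (unit i) ≐∈ d ℤ.* bit b ∷ [])
  scaledUnitBlock i d b d≤aᵢ = goodBlock
    (ℕP.≤-trans (ℕP.≤-reflexive (coeffSize-scale-unit d i)) (ℕP.≤-trans d≤S (ℕP.n≤1+n S)))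
    (λ a≤B j → ℕP.≤-trans (scale-unit-bounded d i j) (ℕP.≤-trans d≤aᵢ (ℕP.m≤n⇒m≤1+n (a≤B i))))
    singleton≤
    (ℕP.≤-trans (∣*bit∣≤ d b) (ℕP.≤-trans d≤S S≤W) ∷ [])
    where d≤S = ℕP.≤-trans d≤aᵢ (∣lookup∣≤coeffSize a i)

  zerosBlock : GoodBlock (zeros n ≐∈ 1ℤ ∷ [])
  zerosBlock = goodBlock (ℕP.≤-trans (ℕP.≤-reflexive (coeffSize-zeros n)) z≤n) (λ {B} _ → zeros-bounded n (suc B))
    singleton≤ (s≤s z≤n ∷ [])

  module BooleanLines (i : Fin n) where

    u : Vec ℤ n
    u = unit i

    axiom : Disj n
    axiom = boolAxiom i

    axiom≈ : ∀ b → axiom ≈ ((u ≐ bit b) ∷ (u ≐ bit (not b)) ∷ [])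
    axiom≈ false = ≈-refl
    axiom≈ true  = swap≈ _ _

    axiom-good : GoodLine axiom
    axiom-good = goodLine ((u ≐∈ 0ℤ ∷ []) ∷ (u ≐∈ 1ℤ ∷ []) ∷ []) (ℕP.n≤1+n 2) (unitBlock i z≤n ∷ unitBlock i ℕP.≤-refl ∷ [])

    scaledLine : Bool → ℤ → Disj n
    scaledLine b d = scaledEq d (u ≐ bit b) ∷ (u ≐ bit (not b)) ∷ []

    scaledLine-good : ∀ b {d} → ∣ d ∣ ≤ ∣ lookup a i ∣ → GoodLine (scaledLine b d)
    scaledLine-good b {d} d≤aᵢ = goodLine ((scale d u ≐∈ d ℤ.* bit b ∷ []) ∷ (u ≐∈ bit (not b) ∷ []) ∷ [])
      (ℕP.n≤1+n 2) (scaledUnitBlock i d b d≤aᵢ ∷ unitBlock i (∣bit∣≤1 (not b)) ∷ [])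

    private
      duplicate : (x y : LinEq n) → (x ∷ y ∷ []) ≈ (x ∷ y ∷ y ∷ [])
      duplicate x y = ∼⇒≈ (prove 2 (x₀ ∪ x₁) (x₀ ∪ (x₁ ∪ x₁)) ((x ∷ []) ∷ (y ∷ []) ∷ []))

      scaledLine≈ : ∀ b d {L} → L ≡ scaledEq d (u ≐ bit b) →
                    scaledLine b d ≈ (L ∷ (u ≐ bit (not b)) ∷ (u ≐ bit (not b)) ∷ [])
      scaledLine≈ b d L≡ = ≈-trans (duplicate _ _) (≈-reflexive (cong (_∷ _) (sym L≡)))

    scaledLine-zero : ∀ {Γ} b → Γ ∋≈ axiom → Rule Γ (scaledLine b 0ℤ)
    scaledLine-zero b ax = resolve⁻ L L _ _ ax ax (axiom≈ b) (axiom≈ b) (scaledLine≈ b 0ℤ (⊖-self L))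
      where L = u ≐ bit b

    scaledLine-suc : ∀ {Γ} b d {d′} → d ℤ.+ 1ℤ ≡ d′ → Γ ∋≈ scaledLine b d → Γ ∋≈ axiom → Rule Γ (scaledLine b d′)
    scaledLine-suc b d refl H ax =
      resolve⁺ (scaledEq d L) L _ _ H ax ≈-refl (axiom≈ b) (scaledLine≈ b (d ℤ.+ 1ℤ) (scaledEq-⊕ d L))
      where L = u ≐ bit b

    scaledLine-pred : ∀ {Γ} b d {d′} → d ℤ.- 1ℤ ≡ d′ → Γ ∋≈ scaledLine b d → Γ ∋≈ axiom → Rule Γ (scaledLine b d′)
    scaledLine-pred b d refl H ax =
      resolve⁻ (scaledEq d L) L _ _ H ax ≈-refl (axiom≈ b) (scaledLine≈ b (d ℤ.- 1ℤ) (scaledEq-⊖ d L))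
      where L = u ≐ bit b

    scaledLine-up : ∀ {Γ} b m → m ≤ ∣ lookup a i ∣ → GoodDerivation Γ → Γ ∋≈ axiom →
                    Extension Γ (suc m) (scaledLine b (ℤ.+ m))
    scaledLine-up b zero    _      g ax = infer g (scaledLine-zero b ax) (scaledLine-good b {0ℤ} z≤n)
    scaledLine-up b (suc m) 1+m≤aᵢ g ax = scaledLine-up b m (ℕP.<⇒≤ 1+m≤aᵢ) g ax >>= λ g′ ext H≈ →
      infer g′ (scaledLine-suc b (ℤ.+ m) (cong ℤ.+_ (ℕP.+-comm m 1)) (here≈ H≈) (∋≈-⊆ ext ax))
            (scaledLine-good b {ℤ.+ suc m} 1+m≤aᵢ)

    scaledLine-down : ∀ {Γ} b m → m ≤ ∣ lookup a i ∣ → GoodDerivation Γ → Γ ∋≈ axiom →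
                      Extension Γ (suc m) (scaledLine b (ℤ.- ℤ.+ m))
    scaledLine-down b zero    _      g ax = infer g (scaledLine-zero b ax) (scaledLine-good b {0ℤ} z≤n)
    scaledLine-down b (suc m) 1+m≤aᵢ g ax = scaledLine-down b m (ℕP.<⇒≤ 1+m≤aᵢ) g ax >>= λ g′ ext H≈ →
      infer g′ (scaledLine-pred b (ℤ.- ℤ.+ m) eq (here≈ H≈) (∋≈-⊆ ext ax)) (scaledLine-good b {ℤ.-[1+ m ]} 1+m≤aᵢ)
      where eq : ℤ.- ℤ.+ m ℤ.- 1ℤ ≡ ℤ.-[1+ m ]
            eq = trans (sym (ℤP.neg-distrib-+ (ℤ.+ m) 1ℤ)) (cong (λ k → ℤ.- ℤ.+ k) (ℕP.+-comm m 1))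

    scaledLine-at : ∀ {Γ} b d → ∣ d ∣ ≤ ∣ lookup a i ∣ → GoodDerivation Γ → Γ ∋≈ axiom →
                    Extension Γ (suc ∣ d ∣) (scaledLine b d)
    scaledLine-at b (ℤ.+ m)     = scaledLine-up b m
    scaledLine-at b ℤ.-[1+ m ] = scaledLine-down b (suc m)

  linesPerUnit : ℕ
  linesPerUnit = 4 * W + 5

  addTerm-lines≤ : ∀ {r m} → r ≤ W → 1 ≤ m → 4 * r + suc m + suc m + 1 ≤ m * linesPerUnit
  addTerm-lines≤ {r} {suc k} r≤W _ = begin
    4 * r + suc (suc k) + suc (suc k) + 1    ≡⟨ regroup r k ⟩
    4 * r + 5 + k * 2                        ≤⟨ ℕP.+-mono-≤ (ℕP.+-monoˡ-≤ 5 (ℕP.*-monoʳ-≤ 4 r≤W)) (ℕP.*-monoʳ-≤ k 2≤) ⟩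
    linesPerUnit + k * linesPerUnit          ∎
    where
      open ℕP.≤-Reasoning
      regroup : ∀ r k → 4 * r + suc (suc k) + suc (suc k) + 1 ≡ 4 * r + 5 + k * 2
      regroup = solve-ℕ
      2≤ : 2 ≤ linesPerUnit
      2≤ = ℕP.≤-trans (s≤s (s≤s z≤n)) (ℕP.m≤n+m 5 (4 * W))

  valueLine : Vec ℤ n → Disj n
  valueLine v = map (v ≐_) (values S v)

  Small : List ℤ → Set
  Small = All (λ β → ∣ β ∣ ≤ S)

  record Progress (Pr Rv : List ℤ) : Set where
    constructor progress
    field
      length≤   : length Pr + length Rv ≤ W
      processed : Small Pr
      pending   : Small Rv

  step : ∀ {Pr α Rv} → Progress Pr (α ∷ Rv) → Progress (α ∷ Pr) Rv
  step {Pr} {α} {Rv} (progress len≤ Pr≤ (α≤ ∷ Rv≤)) =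
    progress (ℕP.≤-trans (ℕP.≤-reflexive (sym (ℕP.+-suc (length Pr) (length Rv)))) len≤) (α≤ ∷ Pr≤) Rv≤

  module AddTerm (i : Fin n) (p : Vec ℤ n) (pᵢ≡0 : lookup p i ≡ 0ℤ)
               (p≤S : coeffSize p ≤ S) (p-dom : Dominated p)
               (p′≤S : coeffSize (addTerm p (lookup a i) i) ≤ S) (p′-dom : Dominated (addTerm p (lookup a i) i)) where

    open BooleanLines i

    c : ℤ
    c = lookup a i

    p′ : Vec ℤ n
    p′ = addTerm p c i

    -- The values in Pr have already been split on xᵢ (into values of p′), those in Rv not yet.
    partialLine : List ℤ → List ℤ → Disj n
    partialLine Pr Rv = ⟪ (p′ ≐∈ shifted c Pr) ∷ (p ≐∈ Rv) ∷ [] ⟫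

    branchLine : Bool → ℤ → List ℤ → List ℤ → Disj n
    branchLine b α Pr Rv = ⟪ (p′ ≐∈ α ℤ.+ c ℤ.* bit b ∷ shifted c Pr) ∷ (p ≐∈ Rv) ∷ (u ≐∈ bit (not b) ∷ []) ∷ [] ⟫

    branchLine-rule : ∀ {Γ} b α Pr Rv → Γ ∋≈ partialLine Pr (α ∷ Rv) → Γ ∋≈ scaledLine b c → Rule Γ (branchLine b α Pr Rv)
    branchLine-rule b α Pr Rv P H = resolve⁺ (p ≐ α) (scaledEq c (u ≐ bit b)) (D ++ (R ++ [])) (γ ∷ []) P H
      (∼⇒≈ (prove 3 (x₁ ∪ ((x₀ ∪ x₂) ∪ ∅)) (x₀ ∪ (x₁ ∪ (x₂ ∪ ∅))) (((p ≐ α) ∷ []) ∷ D ∷ R ∷ [])))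
      ≈-refl
      (∼⇒≈ (prove 4 (x₀ ∪ (x₁ ∪ (x₂ ∪ x₃))) (x₀ ∪ ((x₁ ∪ (x₂ ∪ ∅)) ∪ x₃))
                    (((p′ ≐ α ℤ.+ c ℤ.* bit b) ∷ []) ∷ D ∷ R ∷ (γ ∷ []) ∷ [])))
      where D = map (p′ ≐_) (shifted c Pr)
            R = map (p ≐_) Rv
            γ = u ≐ bit (not b)

    contradiction-rule : ∀ {Γ} α Pr Rv → Γ ∋≈ branchLine false α Pr Rv → Γ ∋≈ branchLine true α Pr Rv →
                         Rule Γ (zeroEq 1ℤ ∷ partialLine (α ∷ Pr) Rv)
    contradiction-rule α Pr Rv F G = resolve⁻ (u ≐ 1ℤ) (u ≐ 0ℤ) (h₀ ∷ D ++ (R ++ [])) (h₁ ∷ D ++ (R ++ [])) F G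
      (half≈ h₀ (u ≐ 1ℤ)) (half≈ h₁ (u ≐ 0ℤ))
      (≈-trans (∼⇒≈ (prove 5 (x₀ ∪ ((x₁ ∪ (x₂ ∪ x₃)) ∪ (x₄ ∪ ∅))) (x₀ ∪ ((x₁ ∪ (x₃ ∪ (x₄ ∪ ∅))) ∪ (x₂ ∪ (x₃ ∪ (x₄ ∪ ∅)))))
                            ((zeroEq 1ℤ ∷ []) ∷ (h₀ ∷ []) ∷ (h₁ ∷ []) ∷ D ∷ R ∷ [])))
               (≈-reflexive (cong (λ v → (v ≐ 1ℤ) ∷ (h₀ ∷ D ++ (R ++ [])) ++ (h₁ ∷ D ++ (R ++ [])))
                                  (sym (zipWith-minus-self u)))))
      where
        D = map (p′ ≐_) (shifted c Pr)
        R = map (p ≐_) Rv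
        h₀ = p′ ≐ α ℤ.+ c ℤ.* bit false
        h₁ = p′ ≐ α ℤ.+ c ℤ.* bit true
        half≈ : ∀ h γ → (h ∷ D ++ (R ++ (γ ∷ []))) ≈ (γ ∷ h ∷ D ++ (R ++ []))
        half≈ h γ = ∼⇒≈ (prove 4 (x₀ ∪ (x₁ ∪ (x₂ ∪ x₃))) (x₃ ∪ (x₀ ∪ (x₁ ∪ (x₂ ∪ ∅)))) ((h ∷ []) ∷ D ∷ R ∷ (γ ∷ []) ∷ []))

    private
      ≤S⇒≤W : ∀ {m} → m ≤ S → m ≤ W
      ≤S⇒≤W m≤S = ℕP.≤-trans m≤S S≤W

      ≤2S⇒≤W : ∀ {m} → m ≤ S + S → m ≤ W
      ≤2S⇒≤W = ℕP.m≤n⇒m≤1+n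

      processedBlock : ∀ {L} → length L ≤ W + W → All (λ β → ∣ β ∣ ≤ S + S) L → GoodBlock (p′ ≐∈ L)
      processedBlock L≤ L-small = goodBlock (ℕP.m≤n⇒m≤1+n p′≤S) p′-dom L≤ (All.map ≤2S⇒≤W L-small)

      pendingBlock : ∀ {L} → length L ≤ W → Small L → GoodBlock (p ≐∈ L)
      pendingBlock L≤ L-small = goodBlock (ℕP.m≤n⇒m≤1+n p≤S) p-dom (ℕP.≤-trans L≤ (ℕP.m≤m+n W W)) (All.map ≤S⇒≤W L-small)

      c≤S : ∣ c ∣ ≤ S
      c≤S = ∣lookup∣≤coeffSize a i

      length-shifted≤ : ∀ L → length L ≤ W → length (shifted c L) ≤ W + W
      length-shifted≤ L L≤W = ℕP.≤-trans (ℕP.≤-reflexive (length-shifted c L)) (ℕP.+-mono-≤ L≤W L≤W)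

    partialBlocks-good : ∀ {Pr Rv} → Progress Pr Rv → All GoodBlock ((p′ ≐∈ shifted c Pr) ∷ (p ≐∈ Rv) ∷ [])
    partialBlocks-good {Pr} {Rv} (progress len≤ Pr≤ Rv≤) =
      processedBlock (length-shifted≤ Pr (ℕP.≤-trans (ℕP.m≤m+n _ _) len≤)) (shifted-bounded c Pr c≤S Pr≤) ∷
      pendingBlock (ℕP.≤-trans (ℕP.m≤n+m _ _) len≤) Rv≤ ∷ []

    partialLine-good : ∀ {Pr Rv} → Progress Pr Rv → GoodLine (partialLine Pr Rv)
    partialLine-good prog = goodLine _ (ℕP.n≤1+n 2) (partialBlocks-good prog)

    contradiction-good : ∀ {α Pr Rv} → Progress Pr (α ∷ Rv) → GoodLine (zeroEq 1ℤ ∷ partialLine (α ∷ Pr) Rv)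
    contradiction-good prog = goodLine _ ℕP.≤-refl (zerosBlock ∷ partialBlocks-good (step prog))

    branchLine-good : ∀ b {α Pr Rv} → Progress Pr (α ∷ Rv) → GoodLine (branchLine b α Pr Rv)
    branchLine-good b {α} {Pr} prog@(progress _ Pr≤ (α≤ ∷ _))
      with processed≤ ∷ pending≤ ∷ [] ← partialBlocks-good (step prog) =
      goodLine _ ℕP.≤-refl
        (processedBlock (ℕP.≤-trans (ℕP.n≤1+n _) (GoodBlock.length≤ processed≤))
                        (∣+*bit∣≤ α c b α≤ c≤S ∷ shifted-bounded c Pr c≤S Pr≤)
         ∷ pending≤ ∷ unitBlock i (∣bit∣≤1 (not b)) ∷ [])

    eliminate : ∀ {Γ} α Pr Rv → Progress Pr (α ∷ Rv) → GoodDerivation Γ →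
                Γ ∋≈ partialLine Pr (α ∷ Rv) → Γ ∋≈ scaledLine false c → Γ ∋≈ scaledLine true c →
                Extension Γ 4 (partialLine (α ∷ Pr) Rv)
    eliminate α Pr Rv prog g P H K =
      infer g (branchLine-rule false α Pr Rv P H) (branchLine-good false prog) >>= λ g₁ ext₁ F≈ →
      infer g₁ (branchLine-rule true α Pr Rv (∋≈-⊆ ext₁ P) (∋≈-⊆ ext₁ K)) (branchLine-good true prog) >>= λ g₂ ext₂ G≈ →
      infer g₂ (contradiction-rule α Pr Rv (∋≈-⊆ ext₂ (here≈ F≈)) (here≈ G≈)) (contradiction-good prog) >>= λ g₃ _ Z≈ →
      infer g₃ (simplify (here≈ Z≈)) (partialLine-good (step prog))

    eliminateAll : ∀ {Γ} Pr α Rv → Progress Pr (α ∷ Rv) → GoodDerivation Γ →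
                   Γ ∋≈ partialLine Pr (α ∷ Rv) → Γ ∋≈ scaledLine false c → Γ ∋≈ scaledLine true c →
                   Extension Γ (4 * suc (length Rv)) (partialLine (Rv ʳ++ α ∷ Pr) [])
    eliminateAll Pr α []       prog g P H K = eliminate α Pr [] prog g P H K
    eliminateAll Pr α (β ∷ Rv) prog g P H K =
      weaken (ℕP.≤-reflexive (trans (ℕP.+-comm _ 4) (sym (ℕP.*-suc 4 (suc (length Rv)))))) (
        eliminate α Pr (β ∷ Rv) prog g P H K >>= λ g′ ext O≈ →
        eliminateAll (α ∷ Pr) β Rv (step prog) g′ (here≈ O≈) (∋≈-⊆ ext H) (∋≈-⊆ ext K))

    valueLine-addTerm : ∀ {P Γ} → 1 ≤ ∣ c ∣ → GoodDerivation (P ∷ Γ) → P ≈ valueLine p →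
            Extension (P ∷ Γ) (∣ c ∣ * linesPerUnit) (valueLine p′)
    valueLine-addTerm {P} c≥1 g P≈ with α , Rv , values≡ ← values-nonempty S p p≤S =
      weaken (addTerm-lines≤ (subst (λ L → length L ≤ W) values≡ (length-values S p)) c≥1) (retarget final≈ (
        infer g (boolAx i ≈-refl) axiom-good >>= λ g₁ ext₁ B≈ →
        scaledLine-at false c ℕP.≤-refl g₁ (here≈ B≈) >>= λ g₂ ext₂ H≈ →
        scaledLine-at true c ℕP.≤-refl g₂ (∋≈-⊆ ext₂ (here≈ B≈)) >>= λ g₃ ext₃ K≈ →
        eliminateAll [] α Rv initial g₃ (∋≈-⊆ ext₃ (∋≈-⊆ ext₂ (∋≈-⊆ ext₁ (here≈ start≈))))
                     (∋≈-⊆ ext₃ (here≈ H≈)) (here≈ K≈)))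
      where
        initial : Progress [] (α ∷ Rv)
        initial = progress (subst (λ L → length L ≤ W) values≡ (length-values S p)) []
                           (subst Small values≡ (values-bounded S p))

        start≈ : P ≈ partialLine [] (α ∷ Rv)
        start≈ = ≈-trans P≈ (≈-reflexive (trans (cong (map (p ≐_)) values≡) (sym (ListP.++-identityʳ _))))

        reorder : ∀ {γ} → γ ∈ Rv ʳ++ α ∷ [] → γ ∈ values S p
        reorder γ∈ = subst (_ ∈_) (sym values≡) (∈-resp-↭ (↭-trans (↭-sym (++↭ʳ++ Rv (α ∷ []))) (↭-sym (∷↭∷ʳ α Rv))) γ∈)

        reorder⁻ : ∀ {γ} → γ ∈ values S p → γ ∈ Rv ʳ++ α ∷ []
        reorder⁻ γ∈ = ∈-resp-↭ (↭-trans (∷↭∷ʳ α Rv) (++↭ʳ++ Rv (α ∷ []))) (subst (_ ∈_) values≡ γ∈)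

        final≈ : partialLine (Rv ʳ++ α ∷ []) [] ≈ valueLine p′
        final≈ = ≈-trans (≈-reflexive (ListP.++-identityʳ _))
          (≐-cong p′ (values-addTerm⁺ S p c i pᵢ≡0 p′≤S ∘ shifted-mono c reorder)
                     (shifted-mono c reorder⁻ ∘ values-addTerm⁻ S p c i p≤S))

  Line : ℕ → Disj n
  Line k = valueLine (prefix k a)

  prefix-dominated : ∀ k → Dominated (prefix k a)
  prefix-dominated k a≤B j = ℕP.m≤n⇒m≤1+n (prefix-bounded k a a≤B j)

  deriveFirstLine : Fin n → Extension [] 5 (Line 0)
  deriveFirstLine i = retarget zero≈ (
    infer ([] , []) (boolAx i ≈-refl) axiom-good >>= λ g₁ _ B≈ →
    scaledLine-at false 0ℤ z≤n g₁ (here≈ B≈) >>= λ g₂ ext₂ H≈ →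
    scaledLine-at true 0ℤ z≤n g₂ (∋≈-⊆ ext₂ (here≈ B≈)) >>= λ g₃ ext₃ K≈ →
    infer g₃ (resolve⁻ (u ≐ 1ℤ) (u ≐ 0ℤ) (h₀ ∷ []) (h₁ ∷ []) (∋≈-⊆ ext₃ (here≈ H≈)) (here≈ K≈) (swap≈ _ _) (swap≈ _ _)
                       (≈-reflexive (cong (λ v → (v ≐ 1ℤ) ∷ h₀ ∷ h₁ ∷ []) (sym (zipWith-minus-self u)))))
             (goodLine ((zeros n ≐∈ 1ℤ ∷ []) ∷ blocks) ℕP.≤-refl (zerosBlock ∷ blocks-good)) >>= λ g₄ _ Z≈ →
    infer g₄ (simplify (here≈ Z≈)) (goodLine blocks (ℕP.n≤1+n 2) blocks-good))
    where
      open BooleanLines i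
      h₀ h₁ : LinEq n
      h₀ = scaledEq 0ℤ (u ≐ bit false)
      h₁ = scaledEq 0ℤ (u ≐ bit true)
      blocks : List (Block n)
      blocks = (scale 0ℤ u ≐∈ 0ℤ ∷ []) ∷ (scale 0ℤ u ≐∈ 0ℤ ∷ []) ∷ []
      blocks-good : All GoodBlock blocks
      blocks-good = scaledUnitBlock i 0ℤ false z≤n ∷ scaledUnitBlock i 0ℤ true z≤n ∷ []
      zero≈ : (h₀ ∷ h₁ ∷ []) ≈ Line 0
      zero≈ = ≈-trans (≈-reflexive (cong (λ v → map (v ≐_) (0ℤ ∷ 0ℤ ∷ [])) (trans (scale-zero u) (sym (prefix-zero a)))))
        (≐-cong (prefix 0 a) (λ { (here refl) → 0∈ ; (there (here refl)) → 0∈ }) (here ∘ only0))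
        where
          0∈ : 0ℤ ∈ values S (prefix 0 a)
          0∈ = subst (_∈ values S (prefix 0 a)) (dot-prefix-zero a _)
                     (∈-values⁺ S (prefix 0 a) (coeffSize-prefix 0 a) (replicate n false))
          only0 : ∀ {β} → β ∈ values S (prefix 0 a) → β ≡ 0ℤ
          only0 β∈ with _ , x , refl ← ∈-values⁻ S (prefix 0 a) β∈ = dot-prefix-zero a x

  deriveNextLine : ∀ {P Γ} k (k<n : k < n) → GoodDerivation (P ∷ Γ) → P ≈ Line k →
             Extension (P ∷ Γ) (∣ lookup a (fromℕ< k<n) ∣ * linesPerUnit) (Line (suc k))
  deriveNextLine k k<n g P≈ with lookup a (fromℕ< k<n) ℤ.≟ 0ℤ
  ... | yes aₖ≡0 = weaken z≤n (stay g (≈-trans P≈ (≈-reflexive (cong valueLine (sym (prefix-suc-zero k k<n a aₖ≡0))))))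
  ... | no  aₖ≢0 = retarget (≈-reflexive (cong valueLine (sym prefix-suc≡)))
                    (AddTerm.valueLine-addTerm (fromℕ< k<n) (prefix k a) (lookup-prefix k k<n a)
                       (coeffSize-prefix k a) (prefix-dominated k)
                       (subst (λ v → coeffSize v ≤ S) prefix-suc≡ (coeffSize-prefix (suc k) a))
                       (subst Dominated prefix-suc≡ (prefix-dominated (suc k)))
                       (ℕP.n≢0⇒n>0 (aₖ≢0 ∘ ℤP.∣i∣≡0⇒i≡0)) g P≈)
    where prefix-suc≡ = prefix-suc k k<n a

  deriveLine : Fin n → ∀ k → k ≤ n → Extension [] (5 + coeffSize (prefix k a) * linesPerUnit) (Line k)
  deriveLine i zero    _   = weaken (ℕP.m≤m+n 5 _) (deriveFirstLine i)
  deriveLine i (suc k) k<n =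
    weaken (ℕP.≤-reflexive cost≡) (deriveLine i k (ℕP.<⇒≤ k<n) >>= λ g _ P≈ → deriveNextLine k k<n g P≈)
    where
      regroup : ∀ x y g → x * g + (5 + y * g) ≡ 5 + (x + y) * g
      regroup = solve-ℕ
      aₖ = ∣ lookup a (fromℕ< k<n) ∣
      cost≡ : aₖ * linesPerUnit + (5 + coeffSize (prefix k a) * linesPerUnit) ≡
              5 + coeffSize (prefix (suc k) a) * linesPerUnit
      cost≡ = trans (regroup aₖ (coeffSize (prefix k a)) linesPerUnit)
                    (cong (λ t → 5 + t * linesPerUnit) (sym (coeffSize-prefix-suc k k<n a)))

  proofSize≤ : ∀ {Γ} → All GoodLine Γ → length Γ ≤ 5 + S * linesPerUnit → proofSize Γ ≤ 288 * (S + 1) ^ 4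
  proofSize≤ {Γ} good len≤ = begin
    proofSize Γ                                 ≤⟨ sum-map-≤ disjSize Γ (All.map GoodLine⇒disjSize good) ⟩
    length Γ * lineSize                         ≤⟨ ℕP.*-monoˡ-≤ lineSize len≤ ⟩
    (5 + S * linesPerUnit) * lineSize                ≤⟨ ℕP.m≤m+n _ _ ⟩
    (5 + S * linesPerUnit) * lineSize + slack S      ≡⟨ expand S ⟩
    288 * (S + 1) ^ 4                           ∎
    where
      open ℕP.≤-Reasoning
      slack : ℕ → ℕ
      slack s = 228 + s * (834 + s * (1074 + s * 492))
      expand : ∀ s → (5 + s * (4 * suc (s + s) + 5)) * (3 * (suc (s + s) + suc (s + s)) * (suc s + suc (s + s)))
                     + (228 + s * (834 + s * (1074 + s * 492))) ≡ 288 * ((s + 1) * ((s + 1) * ((s + 1) * ((s + 1) * 1))))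
      expand = solve-ℕ

  rlinProof : Fin n → Σ (List (Disj n)) λ Γ →
              RlinProof Γ (valueDisj a) × All GoodLine Γ × proofSize Γ ≤ 288 * (S + 1) ^ 4
  rlinProof i = last ∷ earlier , (derivation , last , earlier , refl , ≈-trans last≈ Line-n≈) , allGood ,
                proofSize≤ allGood (ℕP.≤-trans length≤ (ℕP.≤-reflexive lines≡))
    where
      open Extension (deriveLine i n ℕP.≤-refl)
      open GoodDerivation good
      Line-n≈ : Line n ≈ valueDisj a
      Line-n≈ = subst (λ v → valueLine v ≈ valueDisj a) (sym (prefix-full a)) (values≈valueDisj a)
      lines≡ : 5 + coeffSize (prefix n a) * linesPerUnit + 0 ≡ 5 + S * linesPerUnit
      lines≡ = trans (ℕP.+-identityʳ _) (cong (λ s → 5 + s * linesPerUnit) (cong coeffSize (prefix-full a)))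

lemma4p5 : (∃₂ λ (c d : ℕ) → ∀ (n : ℕ) → 1 ≤ n → (a : Vec ℤ n) →
              Σ (List (Disj n)) λ Γ →
                RlinProof Γ (valueDisj a) × (proofSize Γ ≤ c * (coeffSize a + 1) ^ d))
           ×
           (∀ (B : ℕ) → Σ ℕ λ C → Σ ℕ λ K → ∃₂ λ (c d : ℕ) →
              ∀ (n : ℕ) → 1 ≤ n → (a : Vec ℤ n) → (∀ i → ∣ lookup a i ∣ ≤ B) →
              Σ (List (Disj n)) λ Γ →
                RlinProof Γ (valueDisj a) × All (R0Line C K) Γ ×
                (proofSize Γ ≤ c * (coeffSize a + 1) ^ d))
lemma4p5 =
  (288 , 4 , λ n 1≤n a → let Γ , proof , _ , size≤ = rlinProof a (fromℕ< 1≤n) in Γ , proof , size≤) ,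
  (λ B → suc B , 3 , 288 , 4 , λ n 1≤n a a≤B →
     let Γ , proof , good , size≤ = rlinProof a (fromℕ< 1≤n) in
     Γ , proof , All.map (GoodLines.GoodLine⇒R0Line a a≤B) good , size≤)
  where open Construction using (rlinProof)
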